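{- Let $a,m$ be positive integers such that $N=5^{2a}m^2$ is a friend of $10$. Then $m$ is not squarefree.
   Context: For a positive integer $n$, $\sigma(n)$ denotes the sum of the positive divisors of $n$ and $I(n)=\sigma(n)/n$. A positive integer $N>10$ is called a friend of $10$ if $I(N)=9/5$. -}

module Defs where

open import Data.Nat using (ℕ; zero; suc; _+_; _*_; _^_; _<_)
open import Data.Nat.Divisibility using (_∣_; _∣?_)
open import Data.Nat.Primality using (Prime)
open import Data.List using (List; filter; upTo; map)
open import Data.Nat.ListAction using (sum)
open import Data.Product using (_×_)
open import Relation.Binary.PropositionalEquality using (_≡_)
open import Relation.Nullary using (¬_)

σ : ℕ → ℕ
σ n = sum (filter (_∣? n) (map suc (upTo n)))

-- I(N) = σ(N)/N = 9/5, written with denominators cleared: 5·σ(N) = 9·N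
-- (equivalent for N > 0, which holds as N > 10)
FriendOf10 : ℕ → Set
FriendOf10 N = (10 < N) × (5 * σ N ≡ 9 * N)

Squarefree : ℕ → Set
Squarefree m = ∀ p → Prime p → ¬ (p * p ∣ m)

{-# OPTIONS --safe #-}
-- If m is squarefree, then N = 5^(2a) m² = 5^k ∏ q² with q ranging over the primes q ≠ 5
-- dividing m, so multiplicativity of σ gives σ(N) = σ(5^k) ∏ (1 + q + q²). No factor is
-- divisible by 5: σ(5^k) ≡ 1 (mod 5), and q² + q + 1 ≢ 0 (mod 5) for every q. Yet
-- 5 σ(N) = 9 N with 25 ∣ N forces 5 ∣ σ(N).
module Submission where

open import Defs
open import Data.Nat using (ℕ; zero; suc; 2+; s≤s; z≤n; _+_; _*_; _^_; _<_; NonZero; >-nonZero; ≢-nonZero; ≢-nonZero⁻¹; _/_)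
open import Data.Nat.Properties
open import Data.Nat.Divisibility
open import Data.Nat.DivMod using (m*[n/m]≡n)
open import Data.Nat.GCD using (gcd; gcd[m,n]∣m; gcd[m,n]∣n; gcd[m,n]≢0)
open import Data.Nat.Coprimality as Coprimality using (Coprime; coprime-divisor; coprime-/gcd)
open import Data.Nat.Primality using (Prime; prime?; prime⇒irreducible; prime⇒nonZero; ¬prime[1]; euclidsLemma; productOfPrimes≢0)
open import Data.Nat.Primality.Factorisation using (factorise; PrimeFactorisation)
open import Data.Nat.Tactic.RingSolver using (solve-∀)
open import Data.Nat.ListAction using (sum; product)
open import Data.Nat.ListAction.Properties using (sum-++; sum-↭)
open import Data.List using (List; []; _∷_; filter; upTo; map; cartesianProduct; _++_)
open import Data.List.Properties using (map-++; map-∘)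
open import Data.List.Membership.Propositional using (_∈_)
open import Data.List.Membership.Propositional.Properties
  using (∈-filter⁺; ∈-filter⁻; ∈-map⁺; ∈-map⁻; ∈-upTo⁺; ∈-cartesianProduct⁺; ∈-cartesianProduct⁻)
open import Data.List.Membership.Propositional.Properties.WithK using (unique∧set⇒bag)
open import Data.List.Relation.Binary.BagAndSetEquality using (∼bag⇒↭)
open import Data.List.Relation.Unary.Unique.Propositional using (Unique)
import Data.List.Relation.Unary.Unique.Propositional.Properties as Unique
open import Data.List.Relation.Unary.AllPairs using ([]; _∷_)
open import Data.List.Relation.Unary.All as All using (All; []; _∷_)
import Data.List.Relation.Unary.All.Properties as All
open import Data.List.Relation.Unary.Any using (here; there)
open import Data.Product using (_×_; _,_; proj₁; proj₂; ∃₂; uncurry)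
open import Data.Sum using (_⊎_; inj₁; inj₂; [_,_]′)
open import Function.Base using (_∘_)
open import Function.Bundles using (_⇔_; mk⇔; Equivalence)
open import Relation.Binary.PropositionalEquality
open import Relation.Nullary using (¬_; contradiction; yes; no)
open import Relation.Nullary.Decidable using (from-yes; from-no)

private
  variable
    d m n : ℕ

divisors : ℕ → List ℕ
divisors n = filter (_∣? n) (map suc (upTo n))

divisors-unique : ∀ n → Unique (divisors n)
divisors-unique n = Unique.filter⁺ (_∣? n) (Unique.map⁺ suc-injective (Unique.upTo⁺ n))

∈-divisors⁻ : d ∈ divisors n → d ∣ n
∈-divisors⁻ {n = n} d∈ = proj₂ (∈-filter⁻ (_∣? n) {xs = map suc (upTo n)} d∈)

∈-divisors⁺ : .{{NonZero n}} → d ∣ n → d ∈ divisors n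
∈-divisors⁺ {n = n} {zero} d∣n = contradiction (0∣⇒≡0 d∣n) (≢-nonZero⁻¹ n)
∈-divisors⁺ {n = n} {suc d} d∣n = ∈-filter⁺ (_∣? n) (∈-map⁺ suc (∈-upTo⁺ (∣⇒≤ d∣n))) d∣n

σ≡sum : .{{NonZero n}} → {ds : List ℕ} → Unique ds → (∀ {d} → d ∈ ds ⇔ d ∣ n) → σ n ≡ sum ds
σ≡sum {n = n} ds! d∈ds⇔d∣n = sum-↭ (∼bag⇒↭ (unique∧set⇒bag (divisors-unique n) ds! (mk⇔
  (λ d∈ → Equivalence.from d∈ds⇔d∣n (∈-divisors⁻ d∈))
  (λ d∈ → ∈-divisors⁺ (Equivalence.to d∈ds⇔d∣n d∈)))))

unique-map⁺ : {A B : Set} {f : A → B} {xs : List A} →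
              (∀ {x y} → x ∈ xs → y ∈ xs → f x ≡ f y → x ≡ y) → Unique xs → Unique (map f xs)
unique-map⁺ {xs = []}     f-inj []          = []
unique-map⁺ {xs = x ∷ xs} f-inj (x∉xs ∷ xs!) =
  All.map⁺ (All.tabulate λ y∈ fx≡fy → All.lookup x∉xs y∈ (f-inj (here refl) (there y∈) fx≡fy))
  ∷ unique-map⁺ (λ x∈ y∈ → f-inj (there x∈) (there y∈)) xs!

sum-map-*ˡ : ∀ x ys → sum (map (x *_) ys) ≡ x * sum ys
sum-map-*ˡ x []       = sym (*-zeroʳ x)
sum-map-*ˡ x (y ∷ ys) = trans (cong (x * y +_) (sum-map-*ˡ x ys)) (sym (*-distribˡ-+ x y (sum ys)))

sum-cartesianProduct : ∀ xs ys → sum (map (uncurry _*_) (cartesianProduct xs ys)) ≡ sum xs * sum ys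
sum-cartesianProduct []       ys = refl
sum-cartesianProduct (x ∷ xs) ys = begin
  sum (map (uncurry _*_) (map (x ,_) ys ++ cartesianProduct xs ys))
    ≡⟨ cong sum (map-++ (uncurry _*_) (map (x ,_) ys) (cartesianProduct xs ys)) ⟩
  sum (map (uncurry _*_) (map (x ,_) ys) ++ map (uncurry _*_) (cartesianProduct xs ys))
    ≡⟨ sum-++ (map (uncurry _*_) (map (x ,_) ys)) _ ⟩
  sum (map (uncurry _*_) (map (x ,_) ys)) + sum (map (uncurry _*_) (cartesianProduct xs ys))
    ≡⟨ cong₂ _+_ (trans (cong sum (sym (map-∘ ys))) (sum-map-*ˡ x ys)) (sum-cartesianProduct xs ys) ⟩
  x * sum ys + sum xs * sum ys
    ≡⟨ *-distribʳ-+ (sum ys) x (sum xs) ⟨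
  (x + sum xs) * sum ys ∎
  where open ≡-Reasoning

sum-∣ : ∀ {xs} → All (d ∣_) xs → d ∣ sum xs
sum-∣ []           = _ ∣0
sum-∣ (d∣x ∷ d∣xs) = ∣m∣n⇒∣m+n d∣x (sum-∣ d∣xs)

∣-nonZero : .{{NonZero n}} → d ∣ n → NonZero d
∣-nonZero {n} {zero}  d∣n = contradiction (0∣⇒≡0 d∣n) (≢-nonZero⁻¹ n)
∣-nonZero {n} {suc d} d∣n = _

coprime-∣ : ∀ {x y} → Coprime m n → x ∣ m → y ∣ n → Coprime x y
coprime-∣ m⊥n x∣m y∣n (i∣x , i∣y) = m⊥n (∣-trans i∣x x∣m , ∣-trans i∣y y∣n)

-- Take x = gcd d m; then d / x is coprime to m / x and divides (m / x) * n, hence divides n.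
∣*-split : d ∣ m * n → ∃₂ λ x y → x ∣ m × y ∣ n × d ≡ x * y
∣*-split {d} {zero}  {n} _    = d , 1 , d ∣0 , 1∣ n , sym (*-identityʳ d)
∣*-split {d} {m@(suc _)} {n} d∣mn = x , d / x , gcd[m,n]∣n d m , d/x∣n , sym (m*[n/m]≡n (gcd[m,n]∣m d m))
  where
  x : ℕ
  x = gcd d m
  instance
    x≢0 : NonZero x
    x≢0 = ≢-nonZero (gcd[m,n]≢0 d m (inj₂ λ ()))
  x*d/x∣x*m/x*n : x * (d / x) ∣ x * (m / x * n)
  x*d/x∣x*m/x*n = subst₂ _∣_ (sym (m*[n/m]≡n (gcd[m,n]∣m d m)))
    (trans (cong (_* n) (sym (m*[n/m]≡n (gcd[m,n]∣n d m)))) (*-assoc x (m / x) n)) d∣mn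
  d/x∣n : d / x ∣ n
  d/x∣n = coprime-divisor (coprime-/gcd d m) (*-cancelˡ-∣ x x*d/x∣x*m/x*n)

coprime-factors-unique : ∀ {x y x′ y′} → Coprime m n → x ∣ m → y ∣ n → x′ ∣ m → y′ ∣ n →
                         x * y ≡ x′ * y′ → x ≡ x′
coprime-factors-unique {x = x} {y} {x′} {y′} m⊥n x∣m y∣n x′∣m y′∣n xy≡x′y′ = ∣-antisym
  (coprime-divisor (coprime-∣ m⊥n x∣m y′∣n) (subst (x ∣_) (trans xy≡x′y′ (*-comm x′ y′)) (m∣m*n y)))
  (coprime-divisor (coprime-∣ m⊥n x′∣m y∣n) (subst (x′ ∣_) (trans (sym xy≡x′y′) (*-comm x y)) (m∣m*n y′)))

σ-multiplicative : .{{NonZero m}} → .{{NonZero n}} → Coprime m n → σ (m * n) ≡ σ m * σ n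
σ-multiplicative {m} {n} m⊥n =
  trans (σ≡sum {n = m * n} {{m*n≢0 m n}} products-unique (mk⇔ ∈products⇒∣ ∣⇒∈products))
        (sum-cartesianProduct (divisors m) (divisors n))
  where
  pairs : List (ℕ × ℕ)
  pairs = cartesianProduct (divisors m) (divisors n)

  ∈pairs⇒∣ : ∀ {x y} → (x , y) ∈ pairs → x ∣ m × y ∣ n
  ∈pairs⇒∣ xy∈ with x∈ , y∈ ← ∈-cartesianProduct⁻ (divisors m) (divisors n) xy∈ =
    ∈-divisors⁻ x∈ , ∈-divisors⁻ y∈

  product-injective : ∀ {u v} → u ∈ pairs → v ∈ pairs → uncurry _*_ u ≡ uncurry _*_ v → u ≡ v
  product-injective {x , y} {x′ , y′} u∈ v∈ xy≡x′y′
    with x∣m , y∣n ← ∈pairs⇒∣ u∈ | x′∣m , y′∣n ← ∈pairs⇒∣ v∈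
    with refl ← coprime-factors-unique m⊥n x∣m y∣n x′∣m y′∣n xy≡x′y′ =
    cong (x ,_) (*-cancelˡ-≡ y y′ x {{∣-nonZero x∣m}} xy≡x′y′)

  products-unique : Unique (map (uncurry _*_) pairs)
  products-unique = unique-map⁺ product-injective
    (Unique.cartesianProduct⁺ (divisors-unique m) (divisors-unique n))

  ∈products⇒∣ : d ∈ map (uncurry _*_) pairs → d ∣ m * n
  ∈products⇒∣ d∈ with _ , xy∈ , refl ← ∈-map⁻ (uncurry _*_) d∈ =
    uncurry *-pres-∣ (∈pairs⇒∣ xy∈)

  ∣⇒∈products : d ∣ m * n → d ∈ map (uncurry _*_) pairs
  ∣⇒∈products d∣mn with _ , _ , x∣m , y∣n , refl ← ∣*-split {m = m} {n} d∣mn =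
    ∈-map⁺ (uncurry _*_) (∈-cartesianProduct⁺ (∈-divisors⁺ x∣m) (∈-divisors⁺ y∣n))

prime∤⇒coprime : ∀ {p} → Prime p → p ∤ n → Coprime p n
prime∤⇒coprime p-prime p∤n (i∣p , i∣n) with prime⇒irreducible p-prime i∣p
... | inj₁ i≡1 = i≡1
... | inj₂ refl = contradiction i∣n p∤n

∣p*n⇒∣n : ∀ {p} → Prime p → p ∤ d → d ∣ p * n → d ∣ n
∣p*n⇒∣n p-prime p∤d = coprime-divisor (Coprimality.sym (prime∤⇒coprime p-prime p∤d))

∣p*p⇒ : ∀ {p} → Prime p → d ∣ p * p → d ≡ 1 ⊎ d ≡ p ⊎ d ≡ p * p
∣p*p⇒ {d} {p} p-prime d∣pp with p ∣? d
... | yes (divides e refl) with prime⇒irreducible p-prime {e} (*-cancelʳ-∣ p {{prime⇒nonZero p-prime}} d∣pp)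
...   | inj₁ refl = inj₂ (inj₁ (*-identityˡ p))
...   | inj₂ refl = inj₂ (inj₂ refl)
∣p*p⇒ {d} {p} p-prime d∣pp | no p∤d
  with prime⇒irreducible p-prime (∣p*n⇒∣n p-prime p∤d d∣pp)
... | inj₁ d≡1 = inj₁ d≡1
... | inj₂ d≡p = inj₂ (inj₁ d≡p)

σ[p*p] : ∀ {p} → Prime p → σ (p * p) ≡ 1 + p + p * p
σ[p*p] {p@(2+ _)} p-prime = begin
  σ (p * p)                 ≡⟨ σ≡sum ((1≢p ∷ 1≢pp ∷ []) ∷ (p≢pp ∷ []) ∷ [] ∷ []) (mk⇔ ∈⇒∣ ∣⇒∈) ⟩
  1 + (p + (p * p + 0))     ≡⟨ cong (λ s → 1 + (p + s)) (+-identityʳ (p * p)) ⟩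
  1 + p + p * p             ∎
  where
  open ≡-Reasoning
  p<pp : p < p * p
  p<pp = m<m*n p p (s≤s (s≤s z≤n))
  1≢p : 1 ≢ p
  1≢p ()
  1≢pp : 1 ≢ p * p
  1≢pp = <⇒≢ (<-trans (s≤s (s≤s z≤n)) p<pp)
  p≢pp : p ≢ p * p
  p≢pp = <⇒≢ p<pp
  ∈⇒∣ : d ∈ 1 ∷ p ∷ p * p ∷ [] → d ∣ p * p
  ∈⇒∣ (here refl)                = 1∣ (p * p)
  ∈⇒∣ (there (here refl))        = m∣m*n p
  ∈⇒∣ (there (there (here refl))) = ∣-refl
  ∣⇒∈ : d ∣ p * p → d ∈ 1 ∷ p ∷ p * p ∷ []
  ∣⇒∈ d∣pp with ∣p*p⇒ p-prime d∣pp
  ... | inj₁ refl        = here refl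
  ... | inj₂ (inj₁ refl) = there (here refl)
  ... | inj₂ (inj₂ refl) = there (there (here refl))

∣p^k⇒ : ∀ {p} → Prime p → ∀ k → d ∣ p ^ k → d ≡ 1 ⊎ p ∣ d
∣p^k⇒ p-prime zero    d∣1   = inj₁ (∣1⇒≡1 d∣1)
∣p^k⇒ {d} {p} p-prime (suc k) d∣p^k+1 with p ∣? d
... | yes p∣d = inj₂ p∣d
... | no p∤d  = ∣p^k⇒ p-prime k (∣p*n⇒∣n p-prime p∤d d∣p^k+1)

prime∣p^k⇒≡ : ∀ {p q} → Prime p → Prime q → ∀ k → q ∣ p ^ k → q ≡ p
prime∣p^k⇒≡ p-prime q-prime k q∣p^k with ∣p^k⇒ p-prime k q∣p^k
... | inj₁ refl = contradiction q-prime ¬prime[1]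
... | inj₂ p∣q with prime⇒irreducible q-prime p∣q
...   | inj₁ refl = contradiction p-prime ¬prime[1]
...   | inj₂ p≡q  = sym p≡q

-- Every divisor of p ^ k other than 1 is a multiple of p, so σ (p ^ k) ≡ 1 (mod p).
p∤σ[p^k] : ∀ {p} → Prime p → ∀ k → p ∤ σ (p ^ k)
p∤σ[p^k] {p} p-prime k p∣σ =
  p∤1 (∣m+n∣m⇒∣n (subst (p ∣_) (trans σ≡1+Σmultiples (+-comm 1 _)) p∣σ) (sum-∣ p∣multiples))
  where
  instance
    p^k≢0 : NonZero (p ^ k)
    p^k≢0 = m^n≢0 p k {{prime⇒nonZero p-prime}}
  p∤1 : p ∤ 1
  p∤1 p∣1 = contradiction (subst Prime (∣1⇒≡1 p∣1) p-prime) ¬prime[1]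
  multiples : List ℕ
  multiples = filter (p ∣?_) (divisors (p ^ k))
  p∣multiples : All (p ∣_) multiples
  p∣multiples = All.all-filter (p ∣?_) (divisors (p ^ k))
  ∈⇒∣ : d ∈ 1 ∷ multiples → d ∣ p ^ k
  ∈⇒∣ (here refl) = 1∣ _
  ∈⇒∣ (there d∈)  = ∈-divisors⁻ (proj₁ (∈-filter⁻ (p ∣?_) {xs = divisors (p ^ k)} d∈))
  ∣⇒∈ : d ∣ p ^ k → d ∈ 1 ∷ multiples
  ∣⇒∈ d∣p^k with ∣p^k⇒ p-prime k d∣p^k
  ... | inj₁ refl = here refl
  ... | inj₂ p∣d  = there (∈-filter⁺ (p ∣?_) (∈-divisors⁺ d∣p^k) p∣d)
  1∉multiples : All (1 ≢_) multiples
  1∉multiples = All.map (λ p∣d 1≡d → p∤1 (subst (p ∣_) (sym 1≡d) p∣d)) p∣multiples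
  σ≡1+Σmultiples : σ (p ^ k) ≡ 1 + sum multiples
  σ≡1+Σmultiples = σ≡sum (1∉multiples ∷ Unique.filter⁺ (p ∣?_) (divisors-unique (p ^ k))) (mk⇔ ∈⇒∣ ∣⇒∈)

prime∤⇒coprime-square : ∀ {q} → Prime q → q ∤ n → Coprime (q * q) n
prime∤⇒coprime-square q-prime q∤n (i∣qq , i∣n) with ∣p*p⇒ q-prime i∣qq
... | inj₁ i≡1         = i≡1
... | inj₂ (inj₁ refl) = contradiction i∣n q∤n
... | inj₂ (inj₂ refl) = contradiction (m*n∣⇒m∣ _ _ i∣n) q∤n

squarefree-∣ : m ∣ n → Squarefree n → Squarefree m
squarefree-∣ m∣n n-sf p p-prime pp∣m = n-sf p p-prime (∣-trans pp∣m m∣n)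

∤m∧∤n⇒∤m*n : ∀ {p} → Prime p → p ∤ m → p ∤ n → p ∤ m * n
∤m∧∤n⇒∤m*n {m} {n} p-prime p∤m p∤n = [ p∤m , p∤n ]′ ∘ euclidsLemma m n p-prime

module _ {p} (p-prime : Prime p) (p∤1+q+q² : ∀ q → p ∤ 1 + q + q * q) where

  p∤σ[p^k*Π²] : ∀ {qs} → All Prime qs → Squarefree (product qs) → ∀ k →
                p ∤ σ (p ^ k * (product qs * product qs))
  p∤σ[p^k*Π²] [] _ k = subst (λ n → p ∤ σ n) (sym (*-identityʳ (p ^ k))) (p∤σ[p^k] p-prime k)
  p∤σ[p^k*Π²] {q ∷ qs} (q-prime ∷ qs-prime) qqs-sf k with q ≟ p
  ... | yes refl = subst (λ n → p ∤ σ n) (absorb (p ^ k) p (product qs))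
                     (p∤σ[p^k*Π²] qs-prime (squarefree-∣ (n∣m*n q) qqs-sf) (2 + k))
    where
    absorb : ∀ P p m → p * (p * P) * (m * m) ≡ P * (p * m * (p * m))
    absorb = solve-∀
  ... | no q≢p = subst (p ∤_) (sym σ-split)
                   (∤m∧∤n⇒∤m*n p-prime (subst (p ∤_) (sym (σ[p*p] q-prime)) (p∤1+q+q² q))
                                       (p∤σ[p^k*Π²] qs-prime (squarefree-∣ (n∣m*n q) qqs-sf) k))
    where
    r : ℕ
    r = product qs
    pᵏr² : ℕ
    pᵏr² = p ^ k * (r * r)
    q∤pᵏr² : q ∤ pᵏr²
    q∤pᵏr² = ∤m∧∤n⇒∤m*n q-prime (q≢p ∘ prime∣p^k⇒≡ p-prime q-prime k) (∤m∧∤n⇒∤m*n q-prime q∤r q∤r)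
      where
      q∤r : q ∤ r
      q∤r = qqs-sf q q-prime ∘ *-monoʳ-∣ q
    instance
      p≢0 : NonZero p
      p≢0 = prime⇒nonZero p-prime
      q≢0 : NonZero q
      q≢0 = prime⇒nonZero q-prime
      r≢0 : NonZero r
      r≢0 = productOfPrimes≢0 qs-prime
      qq≢0 : NonZero (q * q)
      qq≢0 = m*n≢0 q q
      pᵏr²≢0 : NonZero pᵏr²
      pᵏr²≢0 = m*n≢0 (p ^ k) (r * r) {{m^n≢0 p k}} {{m*n≢0 r r}}
    regroup : ∀ P q m → P * (q * m * (q * m)) ≡ q * q * (P * (m * m))
    regroup = solve-∀
    σ-split : σ (p ^ k * (q * r * (q * r))) ≡ σ (q * q) * σ pᵏr²
    σ-split = trans (cong σ (regroup (p ^ k) q r)) (σ-multiplicative (prime∤⇒coprime-square q-prime q∤pᵏr²))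

  p∤σ[p^k*m*m] : ∀ k {m} .{{_ : NonZero m}} → Squarefree m → p ∤ σ (p ^ k * (m * m))
  p∤σ[p^k*m*m] k {m} m-sf = subst (λ m → p ∤ σ (p ^ k * (m * m))) (sym isFactorisation)
    (p∤σ[p^k*Π²] factorsPrime (subst Squarefree isFactorisation m-sf) k)
    where open PrimeFactorisation (factorise m)

5∤1+q+q² : ∀ q → 5 ∤ 1 + q + q * q
5∤1+q+q² 0 = from-no (5 ∣? 1)
5∤1+q+q² 1 = from-no (5 ∣? 3)
5∤1+q+q² 2 = from-no (5 ∣? 7)
5∤1+q+q² 3 = from-no (5 ∣? 13)
5∤1+q+q² 4 = from-no (5 ∣? 21)
5∤1+q+q² (suc (suc (suc (suc (suc r))))) 5∣ =
  5∤1+q+q² r (∣m+n∣m⇒∣n (subst (5 ∣_) (shift r) 5∣) (m∣m*n (2 * r + 6)))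
  where
  shift : ∀ r → 1 + (5 + r) + (5 + r) * (5 + r) ≡ 5 * (2 * r + 6) + (1 + r + r * r)
  shift = solve-∀

p*x≡c*n⇒p∣x : ∀ {p x c} .{{_ : NonZero p}} → p * p ∣ n → p * x ≡ c * n → p ∣ x
p*x≡c*n⇒p∣x {p = p} {x} {c} (divides y refl) px≡cyp² =
  divides (c * y) (*-cancelˡ-≡ x (c * y * p) p (trans px≡cyp² (regroup c y p)))
  where
  regroup : ∀ c y p → c * (y * (p * p)) ≡ p * (c * y * p)
  regroup = solve-∀

theorem1p9 : (a m : ℕ) → 0 < a → 0 < m → FriendOf10 ((5 ^ (2 * a)) * (m ^ 2)) → ¬ Squarefree m
theorem1p9 a@(suc a-1) m _ m>0 (_ , 5σN≡9N) m-sf =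
  p∤σ[p^k*m*m] prime[5] 5∤1+q+q² (2 * a) {{>-nonZero m>0}} m-sf 5∣σN
  where
  prime[5] : Prime 5
  prime[5] = from-yes (prime? 5)
  25∣N : 5 * 5 ∣ 5 ^ (2 * a) * m ^ 2
  25∣N = ∣m⇒∣m*n (m ^ 2)
    (subst (5 * 5 ∣_) (cong (5 ^_) (sym (*-suc 2 a-1))) (*-monoʳ-∣ 5 (m∣m*n {5} (5 ^ (2 * a-1)))))
  5∣σN : 5 ∣ σ (5 ^ (2 * a) * (m * m))
  5∣σN = subst (λ m² → 5 ∣ σ (5 ^ (2 * a) * m²)) (cong (m *_) (*-identityʳ m))
    (p*x≡c*n⇒p∣x {p = 5} {c = 9} 25∣N 5σN≡9N)
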